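{- Let $M$ be a matroid and let $M'$ be a matroidal retract of $M$. Then $\mathbb{K}[\mathrm{Cyc}(M')]$ is an algebra retract of $\mathbb{K}[\mathrm{Cyc}(M)]$.
   Context: Throughout, matroids are finite and non-free (they have at least one circuit). $\mathbb{K}$ is a field. A cycle of a matroid $M$ is a disjoint union of (possibly zero) circuits; $\mathrm{Cyc}(M)$ is the set of cycles; $\chi_C\in\{0,1\}^{E(M)}$ is the characteristic vector of $C$. The cycle algebra is $\mathbb{K}[\mathrm{Cyc}(M)]=\mathbb{K}[\mathbf{y}^C z: C\in\mathrm{Cyc}(M)]\subseteq\mathbb{K}[y_e,z: e\in E(M)]$, $\mathbf{y}^C=\prod_{e\in C}y_e$, standard graded by $\deg z=1$, $\deg y_e=0$. Matroidal retract: for matroids $M,M'$ with $E(M')\subseteq E(M)$, $M'$ is a matroidal retract of $M$ if there exist maps $\lambda:\mathrm{Cyc}(M')\to\mathrm{Cyc}(M)$ and $\pi:\mathrm{Cyc}(M)\to\mathrm{Cyc}(M')$ such that (a) $\pi\circ\lambda=\mathrm{id}_{\mathrm{Cyc}(M')}$; (b) whenever $\sum_{i=1}^d\chi_{C'_i}=\sum_{i=1}^d\chi_{D'_i}$ for $C'_i,D'_i\in\mathrm{Cyc}(M')$, $d\ge1$, then $\sum_{i=1}^d\chi_{\lambda(C'_i)}=\sum_{i=1}^d\chi_{\lambda(D'_i)}$; (c) whenever $\sum_{i=1}^d\chi_{C_i}=\sum_{i=1}^d\chi_{D_i}$ for $C_i,D_i\in\mathrm{Cyc}(M)$, $d\ge1$,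 then $\sum_{i=1}^d\chi_{\pi(C_i)}=\sum_{i=1}^d\chi_{\pi(D_i)}$. For graded $\mathbb{K}$-algebras $A,B$, $A$ is an algebra retract of $B$ if there are homogeneous $\mathbb{K}$-algebra homomorphisms (not necessarily of degree $0$) $\iota:A\to B$, $\gamma:B\to A$ with $\gamma\circ\iota=\mathrm{id}_A$. -}

module Defs where

open import Level using (Level; _⊔_; suc)
open import Data.Nat as ℕ using (ℕ; _≤_)
open import Data.Bool using (if_then_else_)
open import Data.Vec using (Vec; []; _∷_; replicate; zipWith; map; _++_)
open import Data.Vec.Properties using (≡-dec)
open import Data.List using (List; []; _∷_; foldr; concatMap) renaming (map to mapL; _++_ to _++L_)
open import Data.List.Relation.Unary.All using (All)
open import Data.List.Relation.Unary.AllPairs using (AllPairs)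
open import Data.Fin using (Fin)
open import Data.Fin.Subset using (Subset; _∈_; _⊆_; _∩_; _∪_; _-_)
  renaming (⊥ to ∅)
open import Data.Product using (Σ; ∃; _×_; _,_; proj₁; proj₂)
open import Relation.Nullary using (¬_; yes; no)
open import Relation.Nullary.Decidable using (_×-dec_)
open import Relation.Binary.PropositionalEquality using (_≡_; _≢_)
open import Algebra.Bundles using (CommutativeRing)

record Field (c ℓ : Level) : Set (suc (c ⊔ ℓ)) where
  field
    commutativeRing : CommutativeRing c ℓ
  open CommutativeRing commutativeRing public
  field
    1≉0     : ¬ (1# ≈ 0#)
    inverse : ∀ x → ¬ (x ≈ 0#) → ∃ λ y → x * y ≈ 1#

-- The ambient universe of
-- elements is Fin n; the ground set E(M) is a subset of it, so that two
-- matroids on subsets of the same universe can be compared (E(M') ⊆ E(M)).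

record Matroid (n : ℕ) : Set₁ where
  field
    ground    : Subset n
    Circuit   : Subset n → Set
    circuit⊆  : ∀ {C} → Circuit C → C ⊆ ground
    ∅-not     : ¬ Circuit ∅
    minimal   : ∀ {C D} → Circuit C → Circuit D → C ⊆ D → C ≡ D
    elim      : ∀ {C D e} → Circuit C → Circuit D → C ≢ D → e ∈ (C ∩ D) →
                ∃ λ F → Circuit F × F ⊆ ((C ∪ D) - e)

open Matroid public

NonFree : ∀ {n} → Matroid n → Set
NonFree M = ∃ λ C → Circuit M C

Disjoint : ∀ {n} → Subset n → Subset n → Set
Disjoint p q = p ∩ q ≡ ∅

⋃ : ∀ {n} → List (Subset n) → Subset n
⋃ = foldr _∪_ ∅

IsCycle : ∀ {n} → Matroid n → Subset n → Set
IsCycle M C = ∃ λ (Cs : List (Subset _)) →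
  All (Circuit M) Cs × AllPairs Disjoint Cs × ⋃ Cs ≡ C

Cyc : ∀ {n} → Matroid n → Set
Cyc M = Σ (Subset _) (IsCycle M)

χ : ∀ {n} → Subset n → Vec ℕ n
χ = map (λ b → if b then 1 else 0)

Σχ : ∀ {n d} (M : Matroid n) → Vec (Cyc M) d → Vec ℕ n
Σχ M []       = replicate _ 0
Σχ M (C ∷ Cs) = zipWith ℕ._+_ (χ (proj₁ C)) (Σχ M Cs)

record MatroidalRetract {n} (M' M : Matroid n) : Set where
  field
    ground⊆ : ground M' ⊆ ground M
    λ′      : Cyc M' → Cyc M
    π       : Cyc M → Cyc M'
    retr    : ∀ (C : Cyc M') → proj₁ (π (λ′ C)) ≡ proj₁ C
    λ-resp  : ∀ d → 1 ≤ d → (Cs Ds : Vec (Cyc M') d) →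
              Σχ M' Cs ≡ Σχ M' Ds → Σχ M (map λ′ Cs) ≡ Σχ M (map λ′ Ds)
    π-resp  : ∀ d → 1 ≤ d → (Cs Ds : Vec (Cyc M) d) →
              Σχ M Cs ≡ Σχ M Ds → Σχ M' (map π Cs) ≡ Σχ M' (map π Ds)

-- Graded K-algebras (only the structure needed to speak of homogeneous
-- K-algebra homomorphisms and retracts).

record GradedAlgebra {c ℓ} (K : Field c ℓ) (a b : Level) : Set (suc (c ⊔ ℓ ⊔ a ⊔ b)) where
  module K = Field K
  field
    Carrier : Set a
    _≈_     : Carrier → Carrier → Set b
    _+_ _*_ : Carrier → Carrier → Carrier
    0# 1#   : Carrier
    _·_     : K.Carrier → Carrier → Carrier
    HomogeneousOfDegree : ℕ → Carrier → Set b

  Homogeneous : Carrier → Set b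
  Homogeneous x = ∃ λ d → HomogeneousOfDegree d x

-- homogeneous K-algebra homomorphisms (not necessarily of degree 0):
-- K-algebra homomorphisms sending homogeneous elements to homogeneous ones
record HomogeneousHom {c ℓ a b a' b'} {K : Field c ℓ}
       (A : GradedAlgebra K a b) (B : GradedAlgebra K a' b') : Set (c ⊔ a ⊔ b ⊔ a' ⊔ b') where
  private
    module A = GradedAlgebra A
    module B = GradedAlgebra B
  field
    f      : A.Carrier → B.Carrier
    cong   : ∀ {x y} → x A.≈ y → f x B.≈ f y
    +-hom  : ∀ x y → f (x A.+ y) B.≈ (f x B.+ f y)
    *-hom  : ∀ x y → f (x A.* y) B.≈ (f x B.* f y)
    1-hom  : f A.1# B.≈ B.1#
    ·-hom  : ∀ k x → f (k A.· x) B.≈ (k B.· f x)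
    homog  : ∀ x → A.Homogeneous x → B.Homogeneous (f x)

open HomogeneousHom public

AlgebraRetract : ∀ {c ℓ a b a' b'} {K : Field c ℓ} →
  GradedAlgebra K a b → GradedAlgebra K a' b' → Set (c ⊔ a ⊔ b ⊔ a' ⊔ b')
AlgebraRetract A B =
  Σ (HomogeneousHom A B) λ ι → Σ (HomogeneousHom B A) λ γ →
    ∀ x → f γ (f ι x) ≈ x
  where open GradedAlgebra A

-- The cycle algebra K[Cyc(M)] = K[y^C z : C ∈ Cyc(M)] ⊆ K[y_e, z].
-- Its monomials are y^a z^d with a = χ_{C_1} + … + χ_{C_d}, C_i ∈ Cyc(M).
-- An element is a finite K-linear combination of products of d generators
-- y^{C_1} z ⋯ y^{C_d} z; two such are equal iff for every monomial y^a z^d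
-- of K[y_e, z] they have the same coefficient (i.e. they are equal as
-- polynomials).

module CycleAlgebra {c ℓ} (K : Field c ℓ) {n : ℕ} (M : Matroid n) where
  private module K = Field K

  Word : Set
  Word = Σ ℕ λ d → Vec (Cyc M) d

  Term : Set c
  Term = K.Carrier × Word

  Poly : Set c
  Poly = List Term

  coeff : Poly → ℕ → Vec ℕ n → K.Carrier
  coeff []                      d a = K.0#
  coeff ((k , (d' , Cs)) ∷ p) d a with (d' ℕ.≟ d) ×-dec ≡-dec ℕ._≟_ (Σχ M Cs) a
  ... | yes _ = k K.+ coeff p d a
  ... | no  _ = coeff p d a

  mulTerm : Term → Term → Term
  mulTerm (k , (d , Cs)) (k' , (d' , Ds)) = (k K.* k') , (d ℕ.+ d' , Cs ++ Ds)

  algebra : GradedAlgebra K c ℓ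
  algebra = record
    { Carrier = Poly
    ; _≈_     = λ p q → ∀ d a → coeff p d a K.≈ coeff q d a
    ; _+_     = _++L_
    ; _*_     = λ p q → concatMap (λ t → mapL (mulTerm t) q) p
    ; 0#      = []
    ; 1#      = (K.1# , (0 , [])) ∷ []
    ; _·_     = λ k → mapL (λ { (k' , w) → (k K.* k') , w })
    ; HomogeneousOfDegree = λ d p → ∀ d' a → d' ≢ d → coeff p d' a K.≈ K.0#
    }

K[Cyc] : ∀ {c ℓ} (K : Field c ℓ) {n} → Matroid n → GradedAlgebra K c ℓ
K[Cyc] K M = CycleAlgebra.algebra K M

-- Both λ and π act on a word y^{C₁}z ⋯ y^{C_d}z of the cycle algebra factorwise, hence on
-- K-combinations of words.  Such a combination is determined by its coefficients, i.e. by the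
-- sums of its coefficients over the classes of words with the same degree d and the same
-- monomial a = χ_{C₁} + ⋯ + χ_{C_d}.  Conditions (b) and (c) say that λ and π map classes into
-- classes, so the coefficient of an image at a monomial is a sum of class coefficients of the
-- argument: the induced maps are well defined, and they are multiplicative and degree
-- preserving by construction.  Condition (a) makes γ ∘ ι fix every class.
module Submission where

open import Defs
open import Level using (Level; _⊔_)
open import Function.Base using (_∘_; _on_)
open import Data.Nat as ℕ using (ℕ; zero; suc; _≤_; z≤n; s≤s)
open import Data.Nat.Properties using (≤-refl; ≤-trans)
open import Data.Product using (_×_; _,_; proj₁; proj₂; map₁; map₂; uncurry)
open import Data.Product.Properties using (,-injective) renaming (≡-dec to ×-≡-dec)
open import Data.Vec as Vec using (Vec; []; _∷_)
import Data.Vec.Properties as Vec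
open import Data.List as List using (List; []; _∷_; _++_; length; filter)
import Data.List.Properties as List
open import Relation.Nullary using (Dec; yes; no)
open import Relation.Nullary.Decidable using (¬?; _×-dec_)
open import Relation.Unary using (Pred; Decidable; _≐_)
open import Relation.Binary.Definitions using (DecidableEquality; _Respects_)
open import Relation.Binary.PropositionalEquality as ≡ using (_≡_; _≢_)
open import Data.Empty using (⊥-elim)
open import Algebra.Bundles using (AbelianGroup)

module FormalSums {a ℓ} (G : AbelianGroup a ℓ) where
  open AbelianGroup G
  open import Algebra.Properties.AbelianGroup G using (ε⁻¹≈ε; ⁻¹-∙-comm; x∙y⁻¹≈ε⇒x≈y)
  open import Algebra.Properties.CommutativeSemigroup commutativeSemigroup using (x∙yz≈y∙xz)
  open import Relation.Binary.Reasoning.Setoid setoid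

  private variable
    p q w : Level
    A B : Set p
    W V : Set w
    x y : Carrier

  select : Dec A → Carrier → Carrier
  select (yes _) x = x
  select (no _)  _ = ε

  select-cong : (A? : Dec A) → x ≈ y → select A? x ≈ select A? y
  select-cong (yes _) x≈y = x≈y
  select-cong (no _)  _   = refl

  select-∙ : (A? : Dec A) → ∀ x y → select A? (x ∙ y) ≈ select A? x ∙ select A? y
  select-∙ (yes _) _ _ = refl
  select-∙ (no _)  _ _ = sym (identityˡ ε)

  select-⁻¹ : (A? : Dec A) → ∀ x → select A? (x ⁻¹) ≈ select A? x ⁻¹
  select-⁻¹ (yes _) _ = refl
  select-⁻¹ (no _)  _ = sym ε⁻¹≈ε

  select-≈ε : (A? : Dec A) → (A → x ≈ ε) → select A? x ≈ ε
  select-≈ε (yes a) x≈ε = x≈ε a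
  select-≈ε (no _)  _   = refl

  select-⇔ : (A? : Dec A) (B? : Dec B) → (A → B) → (B → A) → ∀ x → select A? x ≈ select B? x
  select-⇔ (yes _) (yes _) _   _   _ = refl
  select-⇔ (no _)  (no _)  _   _   _ = refl
  select-⇔ (yes a) (no ¬b) A→B _   _ = ⊥-elim (¬b (A→B a))
  select-⇔ (no ¬a) (yes b) _   B→A _ = ⊥-elim (¬a (B→A b))

  FormalSum : Set w → Set (a ⊔ w)
  FormalSum W = List (Carrier × W)

  sumWhere : {P : Pred W p} → Decidable P → FormalSum W → Carrier
  sumWhere P? []            = ε
  sumWhere P? ((k , w) ∷ r) = select (P? w) k ∙ sumWhere P? r

  negate : FormalSum W → FormalSum W
  negate = List.map (map₁ _⁻¹)

  module _ {P : Pred W p} (P? : Decidable P) where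

    sumWhere-++ : ∀ r s → sumWhere P? (r ++ s) ≈ sumWhere P? r ∙ sumWhere P? s
    sumWhere-++ []            s = sym (identityˡ _)
    sumWhere-++ ((k , w) ∷ r) s = trans (∙-congˡ (sumWhere-++ r s)) (sym (assoc _ _ _))

    sumWhere-negate : ∀ r → sumWhere P? (negate r) ≈ sumWhere P? r ⁻¹
    sumWhere-negate []            = sym ε⁻¹≈ε
    sumWhere-negate ((k , w) ∷ r) =
      trans (∙-cong (select-⁻¹ (P? w) k) (sumWhere-negate r)) (⁻¹-∙-comm _ _)

    sumWhere-++-negate : ∀ r s → sumWhere P? (r ++ negate s) ≈ sumWhere P? r ∙ sumWhere P? s ⁻¹
    sumWhere-++-negate r s = trans (sumWhere-++ r (negate s)) (∙-congˡ (sumWhere-negate s))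

    sumWhere-≐ : {Q : Pred W q} (Q? : Decidable Q) → P ≐ Q → ∀ r → sumWhere P? r ≈ sumWhere Q? r
    sumWhere-≐ Q? _         []            = refl
    sumWhere-≐ Q? (P⊆Q , Q⊆P) ((k , w) ∷ r) =
      ∙-cong (select-⇔ (P? w) (Q? w) P⊆Q Q⊆P k) (sumWhere-≐ Q? (P⊆Q , Q⊆P) r)

  sumWhere-map : {P : Pred V p} (P? : Decidable P) (f : W → V) →
                 ∀ r → sumWhere P? (List.map (map₂ f) r) ≡ sumWhere (P? ∘ f) r
  sumWhere-map P? f []            = ≡.refl
  sumWhere-map P? f ((k , w) ∷ r) = ≡.cong (select (P? (f w)) k ∙_) (sumWhere-map P? f r)

  module Classes {w c} {W : Set w} {Cl : Set c} (cls : W → Cl) (_≟_ : DecidableEquality Cl) where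

    classCoeff : Cl → FormalSum W → Carrier
    classCoeff c = sumWhere (λ w → cls w ≟ c)

    dropClass : Cl → FormalSum W → FormalSum W
    dropClass c = filter (λ t → ¬? (cls (proj₂ t) ≟ c))

    classCoeff-dropClass : ∀ c r → classCoeff c (dropClass c r) ≈ ε
    classCoeff-dropClass c []            = refl
    classCoeff-dropClass c ((k , w) ∷ r) with cls w ≟ c
    ... | yes _ = classCoeff-dropClass c r
    ... | no w∉c = trans (∙-cong (select-≈ε (cls w ≟ c) (⊥-elim ∘ w∉c)) (classCoeff-dropClass c r))
                         (identityˡ ε)

    classCoeff-dropClass-≢ : ∀ {c c′} → c′ ≢ c → ∀ r → classCoeff c′ (dropClass c r) ≈ classCoeff c′ r
    classCoeff-dropClass-≢ c′≢c []            = refl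
    classCoeff-dropClass-≢ {c} {c′} c′≢c ((k , w) ∷ r) with cls w ≟ c
    ... | no  _ = ∙-congˡ (classCoeff-dropClass-≢ c′≢c r)
    ... | yes w∈c = begin
      classCoeff c′ (dropClass c r)            ≈⟨ classCoeff-dropClass-≢ c′≢c r ⟩
      classCoeff c′ r                          ≈⟨ identityˡ _ ⟨
      ε ∙ classCoeff c′ r                      ≈⟨ ∙-congʳ w∉c′ ⟨
      select (cls w ≟ c′) k ∙ classCoeff c′ r  ∎
      where w∉c′ = select-≈ε (cls w ≟ c′) (λ w∈c′ → ⊥-elim (c′≢c (≡.trans (≡.sym w∈c′) w∈c)))

    module _ {p} {P : Pred W p} (P? : Decidable P) (resp : P Respects (_≡_ on cls)) where

      sumWhere-splitClass : ∀ w₀ r → sumWhere P? r ≈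
        select (P? w₀) (classCoeff (cls w₀) r) ∙ sumWhere P? (dropClass (cls w₀) r)
      sumWhere-splitClass w₀ [] = sym (trans (identityʳ _) (select-≈ε (P? w₀) (λ _ → refl)))
      sumWhere-splitClass w₀ ((k , w) ∷ r) with cls w ≟ cls w₀
      ... | yes w∼w₀ = begin
        select (P? w) k ∙ sumWhere P? r
          ≈⟨ ∙-cong (select-⇔ (P? w) (P? w₀) (resp w∼w₀) (resp (≡.sym w∼w₀)) k) (sumWhere-splitClass w₀ r) ⟩
        select (P? w₀) k ∙ (select (P? w₀) c₀ ∙ s)  ≈⟨ assoc _ _ _ ⟨
        select (P? w₀) k ∙ select (P? w₀) c₀ ∙ s    ≈⟨ ∙-congʳ (select-∙ (P? w₀) k c₀) ⟨
        select (P? w₀) (k ∙ c₀) ∙ s                 ∎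
        where c₀ = classCoeff (cls w₀) r
              s  = sumWhere P? (dropClass (cls w₀) r)
      ... | no _ = begin
        select (P? w) k ∙ sumWhere P? r              ≈⟨ ∙-congˡ (sumWhere-splitClass w₀ r) ⟩
        select (P? w) k ∙ (select (P? w₀) c₀ ∙ s)   ≈⟨ x∙yz≈y∙xz _ _ _ ⟩
        select (P? w₀) c₀ ∙ (select (P? w) k ∙ s)   ≈⟨ ∙-congʳ (select-cong (P? w₀) (identityˡ c₀)) ⟨
        select (P? w₀) (ε ∙ c₀) ∙ (select (P? w) k ∙ s) ∎
        where c₀ = classCoeff (cls w₀) r
              s  = sumWhere P? (dropClass (cls w₀) r)

      sumWhere≈ε : ∀ r → (∀ w → P w → classCoeff (cls w) r ≈ ε) → sumWhere P? r ≈ ε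
      sumWhere≈ε r = go (length r) r ≤-refl
        where
        -- Induction on the length, discarding the whole class of the first term at each step.
        go : ∀ m r → length r ≤ m → (∀ w → P w → classCoeff (cls w) r ≈ ε) → sumWhere P? r ≈ ε
        go _       []  _ _ = refl
        go (suc m) (t@(k , w) ∷ r) (s≤s |r|≤m) vanish = begin
          sumWhere P? (t ∷ r)
            ≈⟨ sumWhere-splitClass w (t ∷ r) ⟩
          select (P? w) (classCoeff (cls w) (t ∷ r)) ∙ sumWhere P? rest
            ≈⟨ ∙-cong (select-≈ε (P? w) (vanish w)) (go m rest shorter vanish′) ⟩
          ε ∙ ε
            ≈⟨ identityˡ ε ⟩
          ε ∎
          where
          rest = dropClass (cls w) (t ∷ r)
          shorter : length rest ≤ m
          shorter
            rewrite List.filter-reject (λ t → ¬? (cls (proj₂ t) ≟ cls w)) {t} {r} (λ w≁w → w≁w ≡.refl)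
            = ≤-trans (List.length-filter _ r) |r|≤m
          vanish′ : ∀ w′ → P w′ → classCoeff (cls w′) rest ≈ ε
          vanish′ w′ Pw′ with cls w′ ≟ cls w
          ... | yes w′∼w rewrite w′∼w = classCoeff-dropClass (cls w) (t ∷ r)
          ... | no  w′≁w = trans (classCoeff-dropClass-≢ w′≁w (t ∷ r)) (vanish w′ Pw′)

      sumWhere-classCong : ∀ r s → (∀ c → classCoeff c r ≈ classCoeff c s) → sumWhere P? r ≈ sumWhere P? s
      sumWhere-classCong r s r≈s = x∙y⁻¹≈ε⇒x≈y _ _ (begin
        sumWhere P? r ∙ sumWhere P? s ⁻¹  ≈⟨ sumWhere-++-negate P? r s ⟨
        sumWhere P? (r ++ negate s)        ≈⟨ sumWhere≈ε (r ++ negate s) (λ w _ → difference-vanishes (cls w)) ⟩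
        ε                                  ∎)
        where
        difference-vanishes : ∀ c → classCoeff c (r ++ negate s) ≈ ε
        difference-vanishes c = begin
          classCoeff c (r ++ negate s)         ≈⟨ sumWhere-++-negate _ r s ⟩
          classCoeff c r ∙ classCoeff c s ⁻¹  ≈⟨ ∙-congʳ (r≈s c) ⟩
          classCoeff c s ∙ classCoeff c s ⁻¹  ≈⟨ inverseʳ _ ⟩
          ε                                    ∎

PreservesCycleSums : ∀ {n} (M₁ M₂ : Matroid n) → (Cyc M₁ → Cyc M₂) → Set
PreservesCycleSums M₁ M₂ g = ∀ d → 1 ≤ d → (Cs Ds : Vec (Cyc M₁) d) →
  Σχ M₁ Cs ≡ Σχ M₁ Ds → Σχ M₂ (Vec.map g Cs) ≡ Σχ M₂ (Vec.map g Ds)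

module _ {n} (M₁ M₂ : Matroid n) (g : Cyc M₁ → Cyc M₂) where

  Σχ-map : (∀ C → proj₁ (g C) ≡ proj₁ C) →
           ∀ {d} (Cs : Vec (Cyc M₁) d) → Σχ M₂ (Vec.map g Cs) ≡ Σχ M₁ Cs
  Σχ-map g-supp []       = ≡.refl
  Σχ-map g-supp (C ∷ Cs) = ≡.cong₂ (λ D s → Vec.zipWith ℕ._+_ (χ D) s) (g-supp C) (Σχ-map g-supp Cs)

  map-resp-Σχ : PreservesCycleSums M₁ M₂ g → ∀ d (Cs Ds : Vec (Cyc M₁) d) →
                Σχ M₁ Cs ≡ Σχ M₁ Ds → Σχ M₂ (Vec.map g Cs) ≡ Σχ M₂ (Vec.map g Ds)
  map-resp-Σχ g-pres zero    []  []  _ = ≡.refl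
  map-resp-Σχ g-pres (suc d) Cs Ds eq = g-pres (suc d) (s≤s z≤n) Cs Ds eq

module CycleAlgebraCoefficients {c ℓ} (K : Field c ℓ) {n : ℕ} (M : Matroid n) where
  open Field K
  open CycleAlgebra K M public
  open FormalSums +-abelianGroup using (sumWhere; sumWhere-≐)
  private module 𝕂 = GradedAlgebra (K[Cyc] K M)

  -- The monomial y^a z^d of K[y_e, z] represented by a word, encoded as (d , a).
  wordClass : Word → ℕ × Vec ℕ n
  wordClass (d , Cs) = d , Σχ M Cs

  _≟ᶜ_ : DecidableEquality (ℕ × Vec ℕ n)
  _≟ᶜ_ = ×-≡-dec ℕ._≟_ (Vec.≡-dec ℕ._≟_)

  open FormalSums.Classes +-abelianGroup wordClass _≟ᶜ_ public

  coeff≈sumWhere : ∀ p d a →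
    coeff p d a ≈ sumWhere (λ w → (proj₁ w ℕ.≟ d) ×-dec Vec.≡-dec ℕ._≟_ (Σχ M (proj₂ w)) a) p
  coeff≈sumWhere []                     d a = refl
  coeff≈sumWhere ((k , (d′ , Cs)) ∷ p) d a with (d′ ℕ.≟ d) ×-dec Vec.≡-dec ℕ._≟_ (Σχ M Cs) a
  ... | yes _ = +-congˡ (coeff≈sumWhere p d a)
  ... | no  _ = trans (coeff≈sumWhere p d a) (sym (+-identityˡ _))

  coeff≈classCoeff : ∀ p d a → coeff p d a ≈ classCoeff (d , a) p
  coeff≈classCoeff p d a =
    trans (coeff≈sumWhere p d a) (sumWhere-≐ _ _ (uncurry (≡.cong₂ _,_) , ,-injective) p)

  ≈⇒classCoeff≈ : ∀ p q → p 𝕂.≈ q → ∀ c → classCoeff c p ≈ classCoeff c q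
  ≈⇒classCoeff≈ p q p≈q (d , a) =
    trans (sym (coeff≈classCoeff p d a)) (trans (p≈q d a) (coeff≈classCoeff q d a))

  ≡⇒≈ : ∀ {p q} → p ≡ q → p 𝕂.≈ q
  ≡⇒≈ p≡q d a = reflexive (≡.cong (λ r → coeff r d a) p≡q)

module _ {c ℓ} (K : Field c ℓ) {n : ℕ} (M₁ M₂ : Matroid n) (g : Cyc M₁ → Cyc M₂) where
  open Field K
  open import Relation.Binary.Reasoning.Setoid setoid
  open FormalSums +-abelianGroup using (sumWhere; sumWhere-map)
  private
    module A = CycleAlgebraCoefficients K M₁
    module B = CycleAlgebraCoefficients K M₂
    module 𝔸 = GradedAlgebra (K[Cyc] K M₁)
    module 𝔹 = GradedAlgebra (K[Cyc] K M₂)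

  mapWord : A.Word → B.Word
  mapWord (d , Cs) = d , Vec.map g Cs

  mapTerm : A.Term → B.Term
  mapTerm = map₂ mapWord

  mapPoly : A.Poly → B.Poly
  mapPoly = List.map mapTerm

  coeff-mapPoly : ∀ p d a →
    B.coeff (mapPoly p) d a ≈ sumWhere (λ w → B.wordClass (mapWord w) B.≟ᶜ (d , a)) p
  coeff-mapPoly p d a =
    trans (B.coeff≈classCoeff (mapPoly p) d a) (reflexive (sumWhere-map _ mapWord p))

  mapTerm-mulTerm : ∀ t u → mapTerm (A.mulTerm t u) ≡ B.mulTerm (mapTerm t) (mapTerm u)
  mapTerm-mulTerm (k , (d , Cs)) (k′ , (d′ , Ds)) =
    ≡.cong (λ Es → k * k′ , (d ℕ.+ d′ , Es)) (Vec.map-++ g Cs Ds)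

  mapPoly-* : ∀ p q → mapPoly (p 𝔸.* q) ≡ mapPoly p 𝔹.* mapPoly q
  mapPoly-* []      q = ≡.refl
  mapPoly-* (t ∷ p) q = ≡.trans (List.map-++ mapTerm (List.map (A.mulTerm t) q) _)
                                (≡.cong₂ _++_ mapPoly-mulTerm (mapPoly-* p q))
    where
    mapPoly-mulTerm : mapPoly (List.map (A.mulTerm t) q) ≡ List.map (B.mulTerm (mapTerm t)) (mapPoly q)
    mapPoly-mulTerm =
      ≡.trans (≡.sym (List.map-∘ q)) (≡.trans (List.map-cong (mapTerm-mulTerm t) q) (List.map-∘ q))

  mapPoly-· : ∀ k p → mapPoly (k 𝔸.· p) ≡ k 𝔹.· mapPoly p
  mapPoly-· k []      = ≡.refl
  mapPoly-· k (t ∷ p) = ≡.cong (_ ∷_) (mapPoly-· k p)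

  module _ (g-pres : PreservesCycleSums M₁ M₂ g) where

    mapWord-resp : ∀ {w w′} → A.wordClass w ≡ A.wordClass w′ →
                   B.wordClass (mapWord w) ≡ B.wordClass (mapWord w′)
    mapWord-resp {d , Cs} {d′ , Ds} eq with ,-injective eq
    ... | ≡.refl , Σχ≡ = ≡.cong (d ,_) (map-resp-Σχ M₁ M₂ g g-pres d Cs Ds Σχ≡)

    inMappedClass-resp : ∀ c →
      (λ w → B.wordClass (mapWord w) ≡ c) Respects (_≡_ on A.wordClass)
    inMappedClass-resp c {w} {w′} w∼w′ = ≡.trans (≡.sym (mapWord-resp {w} {w′} w∼w′))

    mapPoly-cong : ∀ p q → p 𝔸.≈ q → mapPoly p 𝔹.≈ mapPoly q
    mapPoly-cong p q p≈q d a = begin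
      B.coeff (mapPoly p) d a  ≈⟨ coeff-mapPoly p d a ⟩
      sumWhere P? p            ≈⟨ A.sumWhere-classCong P? (λ {w} {w′} → inMappedClass-resp (d , a) {w} {w′}) p q
                                                       (A.≈⇒classCoeff≈ p q p≈q) ⟩
      sumWhere P? q            ≈⟨ coeff-mapPoly q d a ⟨
      B.coeff (mapPoly q) d a  ∎
      where P? = λ w → B.wordClass (mapWord w) B.≟ᶜ (d , a)

    mapPoly-homogeneous : ∀ e p → 𝔸.HomogeneousOfDegree e p → 𝔹.HomogeneousOfDegree e (mapPoly p)
    mapPoly-homogeneous e p p-hom d a d≢e =
      trans (coeff-mapPoly p d a)
            (A.sumWhere≈ε _ (λ {w} {w′} → inMappedClass-resp (d , a) {w} {w′}) p vanish)
      where
      vanish : ∀ w → B.wordClass (mapWord w) ≡ (d , a) → A.classCoeff (A.wordClass w) p ≈ 0#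
      vanish (d′ , Cs) w↦da =
        trans (sym (A.coeff≈classCoeff p d′ (Σχ M₁ Cs)))
              (p-hom d′ (Σχ M₁ Cs) (λ d′≡e → d≢e (≡.trans (≡.sym (≡.cong proj₁ w↦da)) d′≡e)))

    inducedHom : HomogeneousHom (K[Cyc] K M₁) (K[Cyc] K M₂)
    inducedHom = record
      { f     = mapPoly
      ; cong  = λ {p} {q} → mapPoly-cong p q
      ; +-hom = λ p q → B.≡⇒≈ (List.map-++ mapTerm p q)
      ; *-hom = λ p q → B.≡⇒≈ (mapPoly-* p q)
      ; 1-hom = λ _ _ → refl
      ; ·-hom = λ k p → B.≡⇒≈ (mapPoly-· k p)
      ; homog = λ { p (e , p-hom) → e , mapPoly-homogeneous e p p-hom }
      }

module _ {c ℓ} (K : Field c ℓ) {n : ℕ} where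
  open Field K
  open import Relation.Binary.Reasoning.Setoid setoid

  mapPoly-∘ : (M₁ M₂ M₃ : Matroid n) (g : Cyc M₂ → Cyc M₃) (h : Cyc M₁ → Cyc M₂) →
              ∀ p → mapPoly K M₂ M₃ g (mapPoly K M₁ M₂ h p) ≡ mapPoly K M₁ M₃ (g ∘ h) p
  mapPoly-∘ M₁ M₂ M₃ g h p = ≡.trans (≡.sym (List.map-∘ p)) (List.map-cong mapTerm-∘ p)
    where
    mapTerm-∘ : ∀ t → mapTerm K M₂ M₃ g (mapTerm K M₁ M₂ h t) ≡ mapTerm K M₁ M₃ (g ∘ h) t
    mapTerm-∘ (k , (d , Cs)) = ≡.cong (λ Es → k , (d , Es)) (≡.sym (Vec.map-∘ g h Cs))

  mapPoly≈id : (M : Matroid n) (h : Cyc M → Cyc M) → (∀ C → proj₁ (h C) ≡ proj₁ C) →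
               ∀ p → GradedAlgebra._≈_ (K[Cyc] K M) (mapPoly K M M h p) p
  mapPoly≈id M h h-supp p d a = begin
    coeff (mapPoly K M M h p) d a                                ≈⟨ coeff-mapPoly K M M h p d a ⟩
    sumWhere (λ w → wordClass (mapWord K M M h w) ≟ᶜ (d , a)) p  ≈⟨ sumWhere-≐ _ _ class-preserved p ⟩
    classCoeff (d , a) p                                         ≈⟨ coeff≈classCoeff p d a ⟨
    coeff p d a                                                  ∎
    where
    open CycleAlgebraCoefficients K M
    open FormalSums +-abelianGroup using (sumWhere; sumWhere-≐)
    class-fixed : ∀ w → wordClass (mapWord K M M h w) ≡ wordClass w
    class-fixed (d′ , Cs) = ≡.cong (d′ ,_) (Σχ-map M M h h-supp Cs)
    class-preserved : (λ w → wordClass (mapWord K M M h w) ≡ (d , a)) ≐ (λ w → wordClass w ≡ (d , a))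
    class-preserved = (λ {w} → ≡.trans (≡.sym (class-fixed w))) , (λ {w} → ≡.trans (class-fixed w))

  mapPoly-retraction : (M₁ M₂ : Matroid n) (ι : Cyc M₁ → Cyc M₂) (ρ : Cyc M₂ → Cyc M₁) →
    (∀ C → proj₁ (ρ (ι C)) ≡ proj₁ C) →
    ∀ p → GradedAlgebra._≈_ (K[Cyc] K M₁) (mapPoly K M₂ M₁ ρ (mapPoly K M₁ M₂ ι p)) p
  mapPoly-retraction M₁ M₂ ι ρ ρι-supp p d a =
    trans (CycleAlgebraCoefficients.≡⇒≈ K M₁ (mapPoly-∘ M₁ M₂ M₁ ρ ι p) d a)
          (mapPoly≈id M₁ (ρ ∘ ι) ρι-supp p d a)

theorem4p8 : ∀ {c ℓ} (K : Field c ℓ) {n : ℕ} (M M' : Matroid n) →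
    NonFree M → NonFree M' → MatroidalRetract M' M →
    AlgebraRetract (K[Cyc] K M') (K[Cyc] K M)
theorem4p8 K M M' _ _ R =
  inducedHom K M' M λ′ λ-resp , inducedHom K M M' π π-resp , mapPoly-retraction K M' M λ′ π retr
  where open MatroidalRetract R
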